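{- For every positive integer $i$, the phylogeny graph of a weakly connected $(i,1)$ digraph is diamond-free and chordal.
   Context: All digraphs are finite and simple. An $(i,1)$ digraph is an acyclic digraph in which every vertex has indegree at most $i$ and outdegree at most $1$; weakly connected means the underlying graph is connected. For an acyclic digraph $D$, the phylogeny graph $P(D)$ has vertex set $V(D)$, with $u\ne v$ adjacent iff $(u,v)\in A(D)$, or $(v,u)\in A(D)$, or $u$ and $v$ have a common out-neighbor in $D$. A diamond is $K_4$ minus an edge; diamond-free means no induced diamond. Chordal means no induced cycle of length at least four. -}

module Defs where

open import Data.Nat using (ℕ; zero; suc; _+_; _≤_; _∸_)
open import Data.Fin using (Fin; toℕ)
open import Data.Bool using (Bool; true)
open import Data.List using (List; length; filter)
open import Data.List using () renaming (allFin to allFinL)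
open import Data.Product using (Σ; ∃; ∃-syntax; _×_; _,_)
open import Data.Sum using (_⊎_)
open import Data.Empty using (⊥)
open import Relation.Nullary using (¬_)
open import Relation.Binary.PropositionalEquality using (_≡_; _≢_)
open import Relation.Binary.Construct.Closure.Transitive using (TransClosure)
open import Relation.Binary.Construct.Closure.ReflexiveTransitive using (Star)
open import Relation.Binary.Construct.Closure.Symmetric using (SymClosure)
open import Function.Definitions using (Injective)
open import Data.Bool.Properties using () renaming (_≟_ to _≟B_)

record Digraph (n : ℕ) : Set where
  field
    arc    : Fin n → Fin n → Bool
    noLoop : ∀ v → ¬ (arc v v ≡ true)

open Digraph public

Arc : ∀ {n} → Digraph n → Fin n → Fin n → Set
Arc D u v = arc D u v ≡ true

Acyclic : ∀ {n} → Digraph n → Set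
Acyclic {n} D = ∀ (v : Fin n) → ¬ TransClosure (Arc D) v v

inNbrs : ∀ {n} → Digraph n → Fin n → List (Fin n)
inNbrs {n} D v = filter (λ u → arc D u v ≟B true) (allFinL n)

outNbrs : ∀ {n} → Digraph n → Fin n → List (Fin n)
outNbrs {n} D u = filter (λ v → arc D u v ≟B true) (allFinL n)

indeg outdeg : ∀ {n} → Digraph n → Fin n → ℕ
indeg D v = length (inNbrs D v)
outdeg D v = length (outNbrs D v)

Is-i1-Digraph : ℕ → ∀ {n} → Digraph n → Set
Is-i1-Digraph i {n} D =
  Acyclic D × (∀ (v : Fin n) → indeg D v ≤ i) × (∀ (v : Fin n) → outdeg D v ≤ 1)

WeaklyConnected : ∀ {n} → Digraph n → Set
WeaklyConnected {n} D = ∀ (u v : Fin n) → Star (SymClosure (Arc D)) u v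

PhyAdj : ∀ {n} → Digraph n → Fin n → Fin n → Set
PhyAdj {n} D u v =
  u ≢ v × (Arc D u v ⊎ Arc D v u ⊎ (∃[ w ] (Arc D u w × Arc D v w)))

DiamondFree : ∀ {n} → (Fin n → Fin n → Set) → Set
DiamondFree {n} E =
  ∀ (a b c d : Fin n) →
  a ≢ b → a ≢ c → a ≢ d → b ≢ c → b ≢ d → c ≢ d →
  E a b → E a c → E a d → E b c → E b d → ¬ E c d → ⊥

Consecutive : ∀ {k} → Fin k → Fin k → Set
Consecutive {k} j l =
  toℕ l ≡ suc (toℕ j) ⊎ toℕ j ≡ suc (toℕ l)
  ⊎ (toℕ j ≡ k ∸ 1 × toℕ l ≡ 0) ⊎ (toℕ l ≡ k ∸ 1 × toℕ j ≡ 0)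

InducedCycle : ∀ {n} → (Fin n → Fin n → Set) → (k : ℕ) → (Fin k → Fin n) → Set
InducedCycle E k f =
  Injective _≡_ _≡_ f ×
  (∀ j l → Consecutive j l → E (f j) (f l)) ×
  (∀ j l → E (f j) (f l) → Consecutive j l)

Chordal : ∀ {n} → (Fin n → Fin n → Set) → Set
Chordal {n} E = ∀ (m : ℕ) (f : Fin (4 + m) → Fin n) → ¬ InducedCycle E (4 + m) f

-- Only two properties of an (i,1) digraph D are used: D is acyclic and
-- every vertex has at most one out-neighbour (so D is an in-forest).
--
-- The key local fact (in-arc-from-nonadjacent-pair): if x is adjacent in
-- P(D) to two distinct vertices p, q that are not adjacent to each other,
-- then p → x or q → x is an arc of D.
--
-- * Diamond-freeness: both ends a, b of the diamond's middle edge have the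
--   nonadjacent neighbours c, d, so each receives an arc from c or d.  Unique
--   out-neighbours forbid c → a, c → b (or d → a, d → b); the crossed case
--   c → a, d → b closes a directed cycle of length at most four.
-- * Chordality: an induced cycle of length K ≥ 4 is unrolled into a closed
--   walk h 0, h 1, … (indices taken mod K) whose vertices two steps apart are
--   distinct and nonadjacent.  By the local fact, at each h (1+l) one of the
--   two walk edges points into h (1+l), and an orientation of one edge
--   propagates along the whole walk, producing a directed closed walk.

module Submission where

open import Defs
open import Data.Nat using (ℕ; zero; suc; _+_; _≤_; _<_; _≥_; _∸_; s≤s; z≤n)
open import Data.Nat.Properties
  using (≤-trans; m≤n⇒m≤1+n; n<1+n; <⇒≤; m≤n⇒m<n∨m≡n)
open import Data.Nat.DivMod using (m%n<n; m<n⇒m%n≡m; n%n≡0; [m+n]%n≡m%n)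
open import Data.Product using (_×_; _,_; ∃₂; proj₁; proj₂)
open import Data.Sum using (_⊎_; inj₁; inj₂)
open import Data.Empty using (⊥; ⊥-elim)
open import Data.Bool using (true)
open import Data.Fin using (Fin; toℕ; fromℕ<; _≟_)
open import Data.Fin.Properties using (toℕ-fromℕ<; toℕ-injective)
open import Data.List using (List; length)
open import Data.List.Membership.Propositional using (_∈_)
open import Data.List.Membership.Propositional.Properties
  using (∈-filter⁺; ∈-allFin; ∈-length)
open import Data.List.Relation.Unary.Any using (here; there)
open import Relation.Nullary using (¬_; yes; no)
open import Relation.Binary.PropositionalEquality
  using (_≡_; _≢_; refl; sym; trans; cong; subst; subst₂)
open import Relation.Binary.Construct.Closure.Transitive
  using (TransClosure; [_]; _∷_; _∷ʳ_)
open import Data.Bool.Properties using () renaming (_≟_ to _≟B_)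

-- A list containing two distinct elements has length at least two; this
-- turns the numeric bound  outdeg ≤ 1  into uniqueness of out-neighbours.
distinct-members⇒2≤length : ∀ {A : Set} {x y : A} {xs : List A} →
  x ∈ xs → y ∈ xs → x ≢ y → 2 ≤ length xs
distinct-members⇒2≤length (here refl) (here refl) x≢y = ⊥-elim (x≢y refl)
distinct-members⇒2≤length (here refl) (there y∈) _   = s≤s (∈-length y∈)
distinct-members⇒2≤length (there x∈) (here refl) _   = s≤s (∈-length x∈)
distinct-members⇒2≤length (there x∈) (there y∈) x≢y =
  m≤n⇒m≤1+n (distinct-members⇒2≤length x∈ y∈ x≢y)

record ChordlessClosedWalk {V : Set} (E : V → V → Set) (K : ℕ) (h : ℕ → V) : Set where
  field
    closes₀  : h K ≡ h 0
    closes₁  : h (suc K) ≡ h 1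
    edge     : ∀ l → l < K → E (h l) (h (suc l))
    apart    : ∀ l → l < K → h l ≢ h (2 + l)
    no-chord : ∀ l → l < K → ¬ E (h l) (h (2 + l))

module Unrolling {n : ℕ} (E : Fin n → Fin n → Set) (m : ℕ)
                 (f : Fin (4 + m) → Fin n) (cycle : InducedCycle E (4 + m) f) where

  K : ℕ
  K = 4 + m

  Neighbours : ℕ → ℕ → Set
  Neighbours a b = b ≡ suc a ⊎ a ≡ suc b ⊎ (a ≡ K ∸ 1 × b ≡ 0) ⊎ (b ≡ K ∸ 1 × a ≡ 0)

  position : ℕ → Fin K
  position l = fromℕ< (m%n<n l K)

  walk : ℕ → Fin n
  walk l = f (position l)

  position-below : ∀ {l} → l < K → toℕ (position l) ≡ l
  position-below l<K = trans (toℕ-fromℕ< _) (m<n⇒m%n≡m l<K)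

  position-K : toℕ (position K) ≡ 0
  position-K = trans (toℕ-fromℕ< _) (n%n≡0 K)

  position-1+K : toℕ (position (suc K)) ≡ 1
  position-1+K = trans (toℕ-fromℕ< _) ([m+n]%n≡m%n 1 K)

  edge-at : ∀ l l' {a b} → toℕ (position l) ≡ a → toℕ (position l') ≡ b →
            Neighbours a b → E (walk l) (walk l')
  edge-at _ _ refl refl = proj₁ (proj₂ cycle) _ _

  no-edge-at : ∀ l l' {a b} → toℕ (position l) ≡ a → toℕ (position l') ≡ b →
               ¬ Neighbours a b → ¬ E (walk l) (walk l')
  no-edge-at _ _ refl refl ¬nb e = ¬nb (proj₂ (proj₂ cycle) _ _ e)

  distinct-at : ∀ l l' {a b} → toℕ (position l) ≡ a → toℕ (position l') ≡ b →
                a ≢ b → walk l ≢ walk l'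
  distinct-at _ _ refl refl a≢b e = a≢b (cong toℕ (proj₁ cycle e))

  -- Positions two steps apart along the walk are distinct non-neighbours;
  -- this is where K ≥ 4 is used.  The three cases are the interior of the
  -- cycle and the two wrap-arounds.
  two-steps-apart : ∀ l → l < K →
    ∃₂ λ a b → toℕ (position l) ≡ a × toℕ (position (2 + l)) ≡ b ×
               a ≢ b × ¬ Neighbours a b
  two-steps-apart l l<K with m≤n⇒m<n∨m≡n l<K
  ... | inj₂ refl = _ , _ , position-below l<K , position-1+K , (λ ()) , not-nb
    where
    not-nb : ¬ Neighbours (3 + m) 1
    not-nb (inj₁ ())
    not-nb (inj₂ (inj₁ ()))
    not-nb (inj₂ (inj₂ (inj₁ (_ , ()))))
    not-nb (inj₂ (inj₂ (inj₂ (() , _))))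
  ... | inj₁ 1+l<K with m≤n⇒m<n∨m≡n 1+l<K
  ...   | inj₂ refl = _ , _ , position-below l<K , position-K , (λ ()) , not-nb
    where
    not-nb : ¬ Neighbours (2 + m) 0
    not-nb (inj₁ ())
    not-nb (inj₂ (inj₁ ()))
    not-nb (inj₂ (inj₂ (inj₁ (() , _))))
    not-nb (inj₂ (inj₂ (inj₂ (() , _))))
  ...   | inj₁ 2+l<K = _ , _ , position-below l<K , position-below 2+l<K , (λ ()) , not-nb
    where
    not-nb : ¬ Neighbours l (2 + l)
    not-nb (inj₁ ())
    not-nb (inj₂ (inj₁ ()))
    not-nb (inj₂ (inj₂ (inj₁ (_ , ()))))
    not-nb (inj₂ (inj₂ (inj₂ (() , refl))))

  walk-edge : ∀ l → l < K → E (walk l) (walk (suc l))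
  walk-edge l l<K with m≤n⇒m<n∨m≡n l<K
  ... | inj₁ 1+l<K = edge-at l (suc l) (position-below l<K) (position-below 1+l<K) (inj₁ refl)
  ... | inj₂ refl  = edge-at l (suc l) (position-below l<K) position-K (inj₂ (inj₂ (inj₁ (refl , refl))))

  chordless : ChordlessClosedWalk E K walk
  chordless = record
    { closes₀  = cong f (toℕ-injective position-K)
    ; closes₁  = cong f (toℕ-injective position-1+K)
    ; edge     = walk-edge
    ; apart    = λ l l<K → let (_ , _ , pa , pb , a≢b , _) = two-steps-apart l l<K
                           in distinct-at l (2 + l) pa pb a≢b
    ; no-chord = λ l l<K → let (_ , _ , pa , pb , _ , ¬nb) = two-steps-apart l l<K
                           in no-edge-at l (2 + l) pa pb ¬nb
    }

module InForest {n : ℕ} (D : Digraph n) (acyclic : Acyclic D)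
                (outdeg≤1 : ∀ (v : Fin n) → outdeg D v ≤ 1) where

  infix 4 _~_
  _~_ : Fin n → Fin n → Set
  _~_ = PhyAdj D

  ~-sym : ∀ {u v} → u ~ v → v ~ u
  ~-sym (u≢v , inj₁ uv)                = (λ e → u≢v (sym e)) , inj₂ (inj₁ uv)
  ~-sym (u≢v , inj₂ (inj₁ vu))         = (λ e → u≢v (sym e)) , inj₁ vu
  ~-sym (u≢v , inj₂ (inj₂ (w , uw , vw))) = (λ e → u≢v (sym e)) , inj₂ (inj₂ (w , vw , uw))

  out-unique : ∀ {u w w'} → Arc D u w → Arc D u w' → w ≡ w'
  out-unique {u} {w} {w'} uw uw' with w ≟ w'
  ... | yes w≡w' = w≡w'
  ... | no  w≢w' = ⊥-elim (two≰one (≤-trans two≤outdeg (outdeg≤1 u)))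
    where
    out? = λ v → arc D u v ≟B true
    two≤outdeg : 2 ≤ outdeg D u
    two≤outdeg = distinct-members⇒2≤length (∈-filter⁺ out? (∈-allFin w) uw)
                                           (∈-filter⁺ out? (∈-allFin w') uw') w≢w'
    two≰one : ¬ (2 ≤ 1)
    two≰one (s≤s ())

  no-2-cycle : ∀ {a b} → Arc D a b → Arc D b a → ⊥
  no-2-cycle {a} ab ba = acyclic a (ab ∷ [ ba ])

  -- The key local fact: a vertex x with two distinct nonadjacent neighbours
  -- p, q receives an arc from one of them.  (If x reached both by arcs, or
  -- shared out-neighbours with them, p and q would share x's unique
  -- out-neighbour, or one would point to the other.)
  in-arc-from-nonadjacent-pair : ∀ {x p q} → x ~ p → x ~ q → p ≢ q → ¬ p ~ q →
                                 Arc D p x ⊎ Arc D q x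
  in-arc-from-nonadjacent-pair (_ , inj₂ (inj₁ px)) _ _ _ = inj₁ px
  in-arc-from-nonadjacent-pair _ (_ , inj₂ (inj₁ qx)) _ _ = inj₂ qx
  in-arc-from-nonadjacent-pair (_ , inj₁ xp) (_ , inj₁ xq) p≢q _ = ⊥-elim (p≢q (out-unique xp xq))
  in-arc-from-nonadjacent-pair (_ , inj₁ xp) (_ , inj₂ (inj₂ (w , xw , qw))) p≢q ¬p~q
    with out-unique xp xw
  ... | refl = ⊥-elim (¬p~q (~-sym ((λ e → p≢q (sym e)) , inj₁ qw)))
  in-arc-from-nonadjacent-pair (_ , inj₂ (inj₂ (w , xw , pw))) (_ , inj₁ xq) p≢q ¬p~q
    with out-unique xq xw
  ... | refl = ⊥-elim (¬p~q (p≢q , inj₁ pw))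
  in-arc-from-nonadjacent-pair (_ , inj₂ (inj₂ (w , xw , pw))) (_ , inj₂ (inj₂ (w' , xw' , qw'))) p≢q ¬p~q
    with out-unique xw xw'
  ... | refl = ⊥-elim (¬p~q (p≢q , inj₂ (inj₂ (w , pw , qw'))))

  -- If a ~ d and d → b with a ≢ b, then a → d or a → b: the arc d → a is
  -- excluded because d's only out-neighbour is b, and a common out-neighbour
  -- of a and d must be b.
  adjacent-to-arc-tail : ∀ {a d b} → a ~ d → Arc D d b → a ≢ b → Arc D a d ⊎ Arc D a b
  adjacent-to-arc-tail (_ , inj₁ ad) _ _ = inj₁ ad
  adjacent-to-arc-tail (_ , inj₂ (inj₁ da)) db a≢b = ⊥-elim (a≢b (out-unique da db))
  adjacent-to-arc-tail (_ , inj₂ (inj₂ (w , aw , dw))) db _ with out-unique dw db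
  ... | refl = inj₂ aw

  -- Two crossing arcs c → a, d → b with a ~ d and b ~ c close a directed
  -- cycle of length two, three or four.
  no-crossed-arcs : ∀ {a b c d} → Arc D c a → Arc D d b → a ~ d → b ~ c → a ≢ b → ⊥
  no-crossed-arcs {a} {b} {c} ca db a~d b~c a≢b
    with adjacent-to-arc-tail a~d db a≢b | adjacent-to-arc-tail b~c ca (λ e → a≢b (sym e))
  ... | inj₁ ad | inj₁ bc = acyclic c (ca ∷ ad ∷ db ∷ [ bc ])
  ... | inj₁ ad | inj₂ ba = acyclic a (ad ∷ db ∷ [ ba ])
  ... | inj₂ ab | inj₁ bc = acyclic c (ca ∷ ab ∷ [ bc ])
  ... | inj₂ ab | inj₂ ba = no-2-cycle ab ba

  -- a and b each receive an arc from c or d; the same tail twice contradicts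
  -- out-unique, different tails are crossed arcs.
  diamond-free : DiamondFree _~_
  diamond-free a b c d a≢b _ _ _ _ c≢d a~b a~c a~d b~c b~d ¬c~d
    with in-arc-from-nonadjacent-pair a~c a~d c≢d ¬c~d
       | in-arc-from-nonadjacent-pair b~c b~d c≢d ¬c~d
  ... | inj₁ ca | inj₁ cb = a≢b (out-unique ca cb)
  ... | inj₁ ca | inj₂ db = no-crossed-arcs ca db a~d b~c a≢b
  ... | inj₂ da | inj₁ cb = no-crossed-arcs da cb a~c b~d a≢b
  ... | inj₂ da | inj₂ db = a≢b (out-unique da db)

  -- No chordless closed walk of positive length: at each h (1+l) one of
  -- the two walk edges is an arc into h (1+l), and an arc on one edge forces
  -- the orientation of the neighbouring edge, so one arc orients the whole
  -- walk into a directed closed walk.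
  module _ (k : ℕ) (h : ℕ → Fin n) (walk : ChordlessClosedWalk _~_ (suc k) h) where
    open ChordlessClosedWalk walk

    -- Together with closes₀/closes₁ the walk edges extend one step further.
    edge′ : ∀ l → l ≤ suc k → h l ~ h (suc l)
    edge′ l l≤K with m≤n⇒m<n∨m≡n l≤K
    ... | inj₁ l<K = edge l l<K
    ... | inj₂ refl = subst₂ _~_ (sym closes₀) (sym closes₁) (edge 0 (s≤s z≤n))

    into-middle : ∀ l → l < suc k → Arc D (h l) (h (1 + l)) ⊎ Arc D (h (2 + l)) (h (1 + l))
    into-middle l l<K =
      in-arc-from-nonadjacent-pair (~-sym (edge l l<K)) (edge′ (suc l) l<K) (apart l l<K) (no-chord l l<K)

    forward-step : ∀ l → l < suc k → Arc D (h (1 + l)) (h (2 + l)) → Arc D (h l) (h (1 + l))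
    forward-step l l<K forward with into-middle l l<K
    ... | inj₁ arc = arc
    ... | inj₂ backward = ⊥-elim (no-2-cycle forward backward)

    backward-step : ∀ l → l < suc k → Arc D (h (1 + l)) (h l) → Arc D (h (2 + l)) (h (1 + l))
    backward-step l l<K backward with into-middle l l<K
    ... | inj₁ forward = ⊥-elim (no-2-cycle forward backward)
    ... | inj₂ arc = arc

    -- A forward arc at position j orients every earlier edge forwards.
    forward-walk : ∀ j → j < suc k → Arc D (h j) (h (suc j)) → TransClosure (Arc D) (h 0) (h (suc j))
    forward-walk zero    _   arc = [ arc ]
    forward-walk (suc j) j<K arc = forward-walk j (<⇒≤ j<K) (forward-step j (<⇒≤ j<K) arc) ∷ʳ arc

    -- A backward arc at position 0 orients every later edge backwards.
    module _ (backward₀ : Arc D (h 1) (h 0)) where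
      backward-arc : ∀ j → j < suc k → Arc D (h (suc j)) (h j)
      backward-arc zero    _   = backward₀
      backward-arc (suc j) j<K = backward-step j (<⇒≤ j<K) (backward-arc j (<⇒≤ j<K))

      backward-walk : ∀ j → j < suc k → TransClosure (Arc D) (h (suc j)) (h 0)
      backward-walk zero    j<K = [ backward-arc zero j<K ]
      backward-walk (suc j) j<K = backward-arc (suc j) j<K ∷ backward-walk j (<⇒≤ j<K)

    no-chordless-closed-walk : ⊥
    no-chordless-closed-walk with into-middle k (n<1+n k)
    ... | inj₁ last = acyclic (h 0) (subst (TransClosure (Arc D) (h 0)) closes₀ (forward-walk k (n<1+n k) last))
    ... | inj₂ wrap = acyclic (h 0) (subst (λ v → TransClosure (Arc D) v (h 0)) closes₀
                                           (backward-walk (subst₂ (Arc D) closes₁ closes₀ wrap) k (n<1+n k)))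

  chordal : Chordal _~_
  chordal m f cycle = no-chordless-closed-walk (3 + m) walk chordless
    where open Unrolling _~_ m f cycle using (walk; chordless)

lemma2p5 : (i : ℕ) → i ≥ 1 → (n : ℕ) (D : Digraph n) →
    Is-i1-Digraph i D → WeaklyConnected D →
    DiamondFree (PhyAdj D) × Chordal (PhyAdj D)
lemma2p5 _ _ _ D (acyclic , _ , outdeg≤1) _ = diamond-free , chordal
  where open InForest D acyclic outdeg≤1 using (diamond-free; chordal)
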